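{- For every binary word $w$, $J_{\mathrm{hex}}(1w1)\le Z(w)/2$.
   Context: Words are finite strings over $\{0,1\}$ ($0$ = hydrophobic, $1$ = polar); $Z(w)$ is the number of zeros in $w$, and $1w1$ is the word obtained by adding a $1$ at both ends of $w$. The hexagonal lattice is the (3-regular) graph whose vertices and edges are those of the regular hexagonal (honeycomb) tiling of the plane. A fold of a word $u=u_1\cdots u_n$ in this lattice is a self-avoiding walk $v_1,\dots,v_n$ (distinct vertices, $v_i$ adjacent to $v_{i+1}$). Its score is the number of pairs $\{i,j\}$ with $|i-j|\ge 2$, $u_i=u_j=0$ and $v_i,v_j$ adjacent in the lattice. $J_{\mathrm{hex}}(u)$ is the maximum score over all folds of $u$ in the hexagonal lattice. -}

module Defs where

open import Data.Bool using (Bool; true; false; _∧_; _∨_; not; T)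
open import Data.Nat using (ℕ; suc; _+_; _≤ᵇ_; _≡ᵇ_; _%_)
open import Data.Integer as ℤ using (ℤ; ∣_∣; _-_; 1ℤ)
open import Data.Fin using (Fin; toℕ)
open import Data.List using (List; []; _∷_; _++_; length; lookup; filterᵇ; allFin; concatMap; map; [_])
open import Data.Product using (_×_; _,_; proj₁; proj₂)
open import Function.Definitions using (Injective)
open import Relation.Binary.PropositionalEquality using (_≡_)
open import Relation.Nullary.Decidable using (⌊_⌋)

-- Letters: b0 = hydrophobic (0), b1 = polar (1).
data Bit : Set where
  b0 b1 : Bit

Word : Set
Word = List Bit

isZero : Bit → Bool
isZero b0 = true
isZero b1 = false

Z : Word → ℕ
Z [] = 0
Z (b0 ∷ w) = suc (Z w)
Z (b1 ∷ w) = Z w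

pad : Word → Word
pad w = b1 ∷ (w ++ [ b1 ])

-- Hexagonal (honeycomb) lattice in "brick wall" coordinates: vertices ℤ×ℤ,
-- (x,y) ~ (x±1,y), and (x,y) ~ (x,y+1) when x+y is even
-- (equivalently (x,y) ~ (x,y-1) when x+y is odd).  3-regular, isomorphic to the honeycomb.
Vertex : Set
Vertex = ℤ × ℤ

_==_ : ℤ → ℤ → Bool
a == b = ⌊ a ℤ.≟ b ⌋

isEven : ℤ → Bool
isEven z = (∣ z ∣ % 2) ≡ᵇ 0

adjacent : Vertex → Vertex → Bool
adjacent (x , y) (x' , y') =
  (y == y' ∧ (∣ x - x' ∣ ≡ᵇ 1))
  ∨ (x == x' ∧ ((isEven (x ℤ.+ y) ∧ (y' == (y ℤ.+ 1ℤ)))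
               ∨ (not (isEven (x ℤ.+ y)) ∧ (y' == (y - 1ℤ)))))

Adj : Vertex → Vertex → Set
Adj u v = T (adjacent u v)

record Fold (u : Word) : Set where
  field
    pos       : Fin (length u) → Vertex
    injective : Injective _≡_ _≡_ pos
    walk      : (i j : Fin (length u)) → suc (toℕ i) ≡ toℕ j → Adj (pos i) (pos j)

open Fold public

pairs : (n : ℕ) → List (Fin n × Fin n)
pairs n = concatMap (λ i → map (λ j → (i , j)) (allFin n)) (allFin n)

score : (u : Word) → Fold u → ℕ
score u f = length (filterᵇ ok (pairs (length u)))
  where
  ok : Fin (length u) × Fin (length u) → Bool
  ok (i , j) = ((toℕ i + 2) ≤ᵇ toℕ j)
             ∧ isZero (lookup u i) ∧ isZero (lookup u j)
             ∧ adjacent (pos f i) (pos f j)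

-- Every 0 of 1w1 is an interior letter, so in a fold its two chain neighbours already occupy
-- two of the three lattice neighbours of its vertex: each 0 lies in at most one contact.
-- The contacts therefore form a matching on the zeros of w, whence 2 · score ≤ Z(w).
module Submission where

open import Defs
open import Data.Bool using (Bool; true; false; not; T; if_then_else_; _∧_; _∨_)
open import Data.Bool.Properties using (T-∧; T-∨; not-involutive)
open import Data.Nat using (ℕ; zero; suc; _+_; _*_; _≤_; _<_; z≤n; s≤s; _%_; _≡ᵇ_; _≤ᵇ_)
import Data.Nat.Properties as ℕP
open import Data.Integer as ℤ using (ℤ; ∣_∣; _-_; 1ℤ; +_; -[1+_])
import Data.Integer.Properties as ℤP
open import Data.Integer.Tactic.RingSolver using (solve-∀)
open import Data.Fin as F using (Fin; toℕ; fromℕ<; inject₁)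
import Data.Fin.Properties as FP
open import Data.List using (List; []; _∷_; _++_; [_]; length; lookup; map; allFin; concatMap; cartesianProduct; filterᵇ)
open import Data.List.Properties using (length-map; length-removeAt′)
open import Data.List.Relation.Unary.All as All using (All; []; _∷_)
open import Data.List.Relation.Unary.All.Properties using (all-filter)
open import Data.List.Relation.Unary.Any using (here; there; index; _─_)
open import Data.List.Relation.Unary.AllPairs using ([]; _∷_)
open import Data.List.Relation.Unary.Unique.Propositional using (Unique)
import Data.List.Relation.Unary.Unique.Propositional.Properties as Unique
open import Data.List.Membership.Propositional using (_∈_)
open import Data.List.Membership.Propositional.Properties using (∈-map⁺)
open import Data.Product using (_×_; _,_; proj₁; proj₂; ∃; uncurry)
open import Data.Sum as Sum using (_⊎_; inj₁; inj₂)
open import Data.Empty using (⊥; ⊥-elim)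
open import Function using (_∘_; Equivalence)
open import Relation.Binary.PropositionalEquality using (_≡_; _≢_; refl; sym; trans; cong; subst; module ≡-Reasoning)
open import Relation.Nullary using (¬_)
open import Relation.Nullary.Decidable using (toWitness; decidable-stable)
open import Relation.Nullary.Decidable.Core using (T?)

open Equivalence using (to)

T-== : ∀ {a b} → T (a == b) → a ≡ b
T-== {a} {b} = toWitness {a? = a ℤ.≟ b}

evenᵇ : ℕ → Bool
evenᵇ n = (n % 2) ≡ᵇ 0

evenᵇ-suc : ∀ n → evenᵇ (suc n) ≡ not (evenᵇ n)
evenᵇ-suc zero = refl
evenᵇ-suc (suc zero) = refl
evenᵇ-suc (suc (suc n)) = evenᵇ-suc n

isEven-+1 : ∀ z → isEven (z ℤ.+ 1ℤ) ≡ not (isEven z)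
isEven-+1 (+ n) = trans (cong evenᵇ (ℕP.+-comm n 1)) (evenᵇ-suc n)
isEven-+1 -[1+ zero ] = refl
isEven-+1 -[1+ suc n ] = evenᵇ-suc n

z-1+1≡z : ∀ z → (z - 1ℤ) ℤ.+ 1ℤ ≡ z
z-1+1≡z = solve-∀

z+1-1≡z : ∀ z → (z ℤ.+ 1ℤ) - 1ℤ ≡ z
z+1-1≡z = solve-∀

isEven--1 : ∀ z → isEven (z - 1ℤ) ≡ not (isEven z)
isEven--1 z = begin
  isEven (z - 1ℤ)                   ≡⟨ sym (not-involutive _) ⟩
  not (not (isEven (z - 1ℤ)))       ≡⟨ cong not (sym (isEven-+1 (z - 1ℤ))) ⟩
  not (isEven ((z - 1ℤ) ℤ.+ 1ℤ))    ≡⟨ cong (not ∘ isEven) (z-1+1≡z z) ⟩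
  not (isEven z)                    ∎
  where open ≡-Reasoning

verticalNeighbour : Vertex → Vertex
verticalNeighbour (x , y) = x , (if isEven (x ℤ.+ y) then y ℤ.+ 1ℤ else y - 1ℤ)

neighbours : Vertex → List Vertex
neighbours (x , y) = (x ℤ.+ 1ℤ , y) ∷ (x - 1ℤ , y) ∷ verticalNeighbour (x , y) ∷ []

∣z∣≡1⇒z≡±1 : ∀ z → ∣ z ∣ ≡ 1 → z ≡ 1ℤ ⊎ z ≡ -[1+ 0 ]
∣z∣≡1⇒z≡±1 (+ suc zero) _ = inj₁ refl
∣z∣≡1⇒z≡±1 -[1+ zero ] _ = inj₂ refl

x'≡x-[x-x'] : ∀ x x' → x' ≡ x - (x - x')
x'≡x-[x-x'] = solve-∀

∣x-x'∣≡1⇒x'≡x±1 : ∀ x x' → ∣ x - x' ∣ ≡ 1 → x' ≡ x ℤ.+ 1ℤ ⊎ x' ≡ x - 1ℤ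
∣x-x'∣≡1⇒x'≡x±1 x x' ∣d∣≡1 = Sum.swap (Sum.map x'≡x- x'≡x- (∣z∣≡1⇒z≡±1 (x - x') ∣d∣≡1))
  where
  x'≡x- : ∀ {d} → x - x' ≡ d → x' ≡ x - d
  x'≡x- x-x'≡d = trans (x'≡x-[x-x'] x x') (cong (x -_) x-x'≡d)

isEven-x+[y+1] : ∀ x y → isEven (x ℤ.+ (y ℤ.+ 1ℤ)) ≡ not (isEven (x ℤ.+ y))
isEven-x+[y+1] x y = trans (cong isEven (sym (ℤP.+-assoc x y 1ℤ))) (isEven-+1 (x ℤ.+ y))

isEven-x+[y-1] : ∀ x y → isEven (x ℤ.+ (y - 1ℤ)) ≡ not (isEven (x ℤ.+ y))
isEven-x+[y-1] x y = trans (cong isEven (sym (ℤP.+-assoc x y (ℤ.- 1ℤ)))) (isEven--1 (x ℤ.+ y))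

verticalNeighbour-involutive : ∀ v → verticalNeighbour (verticalNeighbour v) ≡ v
verticalNeighbour-involutive (x , y) with isEven (x ℤ.+ y) in parity
... | true  rewrite isEven-x+[y+1] x y | parity = cong (x ,_) (z+1-1≡z y)
... | false rewrite isEven-x+[y-1] x y | parity = cong (x ,_) (z-1+1≡z y)

vertical-step : ∀ b {y y'} → T ((b ∧ (y' == (y ℤ.+ 1ℤ))) ∨ (not b ∧ (y' == (y - 1ℤ)))) →
                y' ≡ (if b then y ℤ.+ 1ℤ else y - 1ℤ)
vertical-step true h with to T-∨ h
... | inj₁ y'≡y+1 = T-== y'≡y+1
vertical-step false h = T-== h

Adj⇒∈neighbours : ∀ u v → Adj u v → v ∈ neighbours u
Adj⇒∈neighbours (x , y) (x' , y') adj with to T-∨ adj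
... | inj₁ horizontal with to T-∧ horizontal
...   | y≡y' , ∣x-x'∣≡1 with T-== {y} {y'} y≡y'
...     | refl = Sum.[ here ∘ cong (_, y) , there ∘ here ∘ cong (_, y) ]
                   (∣x-x'∣≡1⇒x'≡x±1 x x' (ℕP.≡ᵇ⇒≡ _ 1 ∣x-x'∣≡1))
Adj⇒∈neighbours (x , y) (x' , y') adj | inj₂ vertical with to T-∧ vertical
... | x≡x' , y'≡ with T-== {x} {x'} x≡x'
...   | refl = there (there (here (cong (x ,_) (vertical-step (isEven (x ℤ.+ y)) {y} y'≡))))

∈neighbours-sym : ∀ u v → v ∈ neighbours u → u ∈ neighbours v
∈neighbours-sym (x , y) _ (here refl) = there (here (cong (_, y) (sym (z+1-1≡z x))))
∈neighbours-sym (x , y) _ (there (here refl)) = here (cong (_, y) (sym (z-1+1≡z x)))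
∈neighbours-sym (x , y) _ (there (there (here refl))) =
  there (there (here (sym (verticalNeighbour-involutive (x , y)))))

module _ {A : Set} where

  ∈-─ : ∀ {x z : A} {ys} → z ∈ ys → z ≢ x → (x∈ys : x ∈ ys) → z ∈ (ys ─ x∈ys)
  ∈-─ (here z≡y)  z≢x (here x≡y)  = ⊥-elim (z≢x (trans z≡y (sym x≡y)))
  ∈-─ (here z≡y)  z≢x (there x∈ys) = here z≡y
  ∈-─ (there z∈ys) z≢x (here x≡y)  = z∈ys
  ∈-─ (there z∈ys) z≢x (there x∈ys) = there (∈-─ z∈ys z≢x x∈ys)

  Unique∧⊆⇒length≤ : ∀ {xs ys : List A} → Unique xs → All (_∈ ys) xs → length xs ≤ length ys
  Unique∧⊆⇒length≤ [] [] = z≤n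
  Unique∧⊆⇒length≤ {ys = ys} (x∉xs ∷ unique) (x∈ys ∷ xs⊆ys) =
    subst (_ ≤_) (sym (length-removeAt′ ys (index x∈ys)))
      (s≤s (Unique∧⊆⇒length≤ unique
             (All.zipWith (λ (x≢z , z∈ys) → ∈-─ z∈ys (x≢z ∘ sym) x∈ys) (x∉xs , xs⊆ys))))

module _ {B : Set} where

  endpoints : List (B × B) → List B
  endpoints [] = []
  endpoints ((a , b) ∷ C) = a ∷ b ∷ endpoints C

  length-endpoints : ∀ C → length (endpoints C) ≡ 2 * length C
  length-endpoints [] = refl
  length-endpoints (_ ∷ C) = trans (cong (suc ∘ suc) (length-endpoints C)) (sym (ℕP.*-suc 2 (length C)))

  All-endpoints : ∀ {P : B → Set} {C} → All (λ (a , b) → P a × P b) C → All P (endpoints C)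
  All-endpoints [] = []
  All-endpoints ((Pa , Pb) ∷ PC) = Pa ∷ Pb ∷ All-endpoints PC

  module _ (R : B → B → Set) (R-asym : ∀ {a b} → R a b → R b a → ⊥)
           (partner-unique : ∀ {k x y} → R k x ⊎ R x k → R k y ⊎ R y k → x ≡ y) where

    private
      reversed : ∀ {a b c} → b ≡ c → R a b → R c a → ⊥
      reversed refl = R-asym

      disjoint : ∀ {a b c d} → R a b → R c d → (a , b) ≢ (c , d) → (a ≢ c × a ≢ d) × (b ≢ c × b ≢ d)
      disjoint Rab Rcd ab≢cd =
        ( (λ { refl → ab≢cd (cong (_ ,_) (partner-unique (inj₁ Rab) (inj₁ Rcd))) })
        , (λ { refl → reversed (partner-unique (inj₁ Rab) (inj₂ Rcd)) Rab Rcd }) )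
        , ( (λ { refl → reversed (partner-unique (inj₁ Rcd) (inj₂ Rab)) Rcd Rab })
          , (λ { refl → ab≢cd (cong (_, _) (partner-unique (inj₂ Rab) (inj₂ Rcd))) }) )

    Unique-endpoints : ∀ {C} → All (uncurry R) C → Unique C → Unique (endpoints C)
    Unique-endpoints [] [] = []
    Unique-endpoints (Rab ∷ RC) (ab∉C ∷ unique) =
      ((λ { refl → R-asym Rab Rab }) ∷ All-endpoints (All.map proj₁ disjoints))
      ∷ All-endpoints (All.map proj₂ disjoints)
      ∷ Unique-endpoints RC unique
      where
      disjoints = All.zipWith (λ (Rcd , ab≢cd) → disjoint Rab Rcd ab≢cd) (RC , ab∉C)

IsZeroAt : (u : Word) → Fin (length u) → Set
IsZeroAt u k = T (isZero (lookup u k))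

zeroPositions : (u : Word) → List (Fin (length u))
zeroPositions [] = []
zeroPositions (b0 ∷ u) = F.zero ∷ map F.suc (zeroPositions u)
zeroPositions (b1 ∷ u) = map F.suc (zeroPositions u)

length-zeroPositions : ∀ u → length (zeroPositions u) ≡ Z u
length-zeroPositions [] = refl
length-zeroPositions (b0 ∷ u) = cong suc (trans (length-map F.suc (zeroPositions u)) (length-zeroPositions u))
length-zeroPositions (b1 ∷ u) = trans (length-map F.suc (zeroPositions u)) (length-zeroPositions u)

∈-zeroPositions : ∀ u {k} → IsZeroAt u k → k ∈ zeroPositions u
∈-zeroPositions (b0 ∷ u) {F.zero} _ = here refl
∈-zeroPositions (b0 ∷ u) {F.suc k} z = there (∈-map⁺ F.suc (∈-zeroPositions u z))
∈-zeroPositions (b1 ∷ u) {F.suc k} z = ∈-map⁺ F.suc (∈-zeroPositions u z)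

Z-pad : ∀ w → Z (pad w) ≡ Z w
Z-pad [] = refl
Z-pad (b0 ∷ w) = cong suc (Z-pad w)
Z-pad (b1 ∷ w) = Z-pad w

zero-not-last : ∀ u (k : Fin (length (u ++ [ b1 ]))) → IsZeroAt (u ++ [ b1 ]) k →
                suc (toℕ k) < length (u ++ [ b1 ])
zero-not-last []          F.zero    ()
zero-not-last (_ ∷ [])    F.zero    _ = s≤s (s≤s z≤n)
zero-not-last (_ ∷ _ ∷ _) F.zero    _ = s≤s (s≤s z≤n)
zero-not-last (_ ∷ u)     (F.suc k) z = s≤s (zero-not-last u k z)

pad-zero-interior : ∀ w {k} → IsZeroAt (pad w) k →
                    ∃ (λ (k⁻ : Fin (length (pad w))) → suc (toℕ k⁻) ≡ toℕ k)
                  × ∃ (λ (k⁺ : Fin (length (pad w))) → suc (toℕ k) ≡ toℕ k⁺)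
pad-zero-interior w {F.suc j} z =
  (inject₁ j , cong suc (FP.toℕ-inject₁ j)) , (fromℕ< j+2≤n , sym (FP.toℕ-fromℕ< j+2≤n))
  where
  j+2≤n : suc (suc (toℕ j)) < length (pad w)
  j+2≤n = s≤s (zero-not-last w j z)

Far : ℕ → ℕ → Set
Far m j = m + 2 ≤ j ⊎ j + 2 ≤ m

n+2≰1+n : ∀ n → ¬ (n + 2 ≤ suc n)
n+2≰1+n n le = ℕP.n≮n (suc n) (subst (_≤ suc n) (ℕP.+-comm n 2) le)

1+n+2≰n : ∀ n → ¬ (suc n + 2 ≤ n)
1+n+2≰n n le = ℕP.n≮n n (ℕP.m+n≤o⇒m≤o (suc n) le)

Far⇒pred≢ : ∀ {p m j} → suc p ≡ m → Far m j → p ≢ j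
Far⇒pred≢ refl (inj₁ le) refl = 1+n+2≰n _ le
Far⇒pred≢ refl (inj₂ le) refl = n+2≰1+n _ le

Far⇒suc≢ : ∀ {m q j} → suc m ≡ q → Far m j → q ≢ j
Far⇒suc≢ refl (inj₁ le) refl = n+2≰1+n _ le
Far⇒suc≢ refl (inj₂ le) refl = 1+n+2≰n _ le

pred≢suc : ∀ {p m q} → suc p ≡ m → suc m ≡ q → p ≢ q
pred≢suc refl refl ()

-- Position k, its two chain neighbours and two distinct far neighbours would be
-- four distinct lattice neighbours of pos k, but the lattice is 3-regular.
far-neighbour-unique : ∀ {u} (f : Fold u) {k k⁻ k⁺ x y : Fin (length u)} →
  suc (toℕ k⁻) ≡ toℕ k → suc (toℕ k) ≡ toℕ k⁺ →
  Far (toℕ k) (toℕ x) → Far (toℕ k) (toℕ y) →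
  Adj (pos f k) (pos f x) ⊎ Adj (pos f x) (pos f k) →
  Adj (pos f k) (pos f y) ⊎ Adj (pos f y) (pos f k) → x ≡ y
far-neighbour-unique f {k} {k⁻} {k⁺} {x} {y} k⁻→k k→k⁺ far-x far-y adj-x adj-y =
  decidable-stable (x F.≟ y) λ x≢y →
    ℕP.n≮n 3 (Unique∧⊆⇒length≤ (Unique.map⁺ (injective f) (Unique.map⁻ (distinct x≢y))) near)
  where
  distinct : x ≢ y → Unique (map toℕ (k⁻ ∷ k⁺ ∷ x ∷ y ∷ []))
  distinct x≢y =
      (pred≢suc k⁻→k k→k⁺ ∷ Far⇒pred≢ k⁻→k far-x ∷ Far⇒pred≢ k⁻→k far-y ∷ [])
    ∷ (Far⇒suc≢ k→k⁺ far-x ∷ Far⇒suc≢ k→k⁺ far-y ∷ [])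
    ∷ (x≢y ∘ FP.toℕ-injective ∷ [])
    ∷ []
    ∷ []
  neighbour : ∀ {v} → Adj (pos f k) v ⊎ Adj v (pos f k) → v ∈ neighbours (pos f k)
  neighbour = Sum.[ Adj⇒∈neighbours _ _ , ∈neighbours-sym _ _ ∘ Adj⇒∈neighbours _ _ ]
  near : All (_∈ neighbours (pos f k)) (map (pos f) (k⁻ ∷ k⁺ ∷ x ∷ y ∷ []))
  near = neighbour (inj₂ (walk f k⁻ k k⁻→k)) ∷ neighbour (inj₁ (walk f k k⁺ k→k⁺))
       ∷ neighbour adj-x ∷ neighbour adj-y ∷ []

pairs≡cartesianProduct : ∀ n → pairs n ≡ cartesianProduct (allFin n) (allFin n)
pairs≡cartesianProduct n = go (allFin n)
  where
  go : (xs : List (Fin n)) → concatMap (λ i → map (i ,_) (allFin n)) xs ≡ cartesianProduct xs (allFin n)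
  go [] = refl
  go (i ∷ xs) = cong (map (i ,_) (allFin n) ++_) (go xs)

Unique-pairs : ∀ n → Unique (pairs n)
Unique-pairs n = subst Unique (sym (pairs≡cartesianProduct n))
                   (Unique.cartesianProduct⁺ (Unique.allFin⁺ n) (Unique.allFin⁺ n))

module _ {u : Word} (f : Fold u) where

  Contact : Fin (length u) → Fin (length u) → Set
  Contact i j = toℕ i + 2 ≤ toℕ j × IsZeroAt u i × IsZeroAt u j × Adj (pos f i) (pos f j)

  contactᵇ : Fin (length u) × Fin (length u) → Bool
  contactᵇ (i , j) = ((toℕ i + 2) ≤ᵇ toℕ j)
                   ∧ isZero (lookup u i) ∧ isZero (lookup u j)
                   ∧ adjacent (pos f i) (pos f j)

  contacts : List (Fin (length u) × Fin (length u))
  contacts = filterᵇ contactᵇ (pairs (length u))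

  score≡length-contacts : score u f ≡ length contacts
  score≡length-contacts = refl

  T-contactᵇ : ∀ {i j} → T (contactᵇ (i , j)) → Contact i j
  T-contactᵇ t with to T-∧ t
  ... | far , t′ with to T-∧ t′
  ...   | zi , t″ with to T-∧ t″
  ...     | zj , adj = ℕP.≤ᵇ⇒≤ _ _ far , zi , zj , adj

  All-Contact-contacts : All (uncurry Contact) contacts
  All-Contact-contacts = All.map T-contactᵇ (all-filter (T? ∘ contactᵇ) (pairs (length u)))

  Unique-contacts : Unique contacts
  Unique-contacts = Unique.filter⁺ (T? ∘ contactᵇ) (Unique-pairs (length u))

  Contact-asym : ∀ {i j} → Contact i j → Contact j i → ⊥
  Contact-asym (i+2≤j , _) (j+2≤i , _) = ℕP.<-asym (+2≤⇒< i+2≤j) (+2≤⇒< j+2≤i)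
    where
    +2≤⇒< : ∀ {m n} → m + 2 ≤ n → m < n
    +2≤⇒< {m} = ℕP.<-≤-trans (ℕP.m<m+n m (s≤s z≤n))

  Contact⇒far-neighbour : ∀ {k x} → Contact k x ⊎ Contact x k →
    IsZeroAt u k × Far (toℕ k) (toℕ x) × (Adj (pos f k) (pos f x) ⊎ Adj (pos f x) (pos f k))
  Contact⇒far-neighbour (inj₁ (le , zk , _ , adj)) = zk , inj₁ le , inj₁ adj
  Contact⇒far-neighbour (inj₂ (le , _ , zk , adj)) = zk , inj₂ le , inj₂ adj

Contact-partner-unique : ∀ w (f : Fold (pad w)) {k x y} →
  Contact f k x ⊎ Contact f x k → Contact f k y ⊎ Contact f y k → x ≡ y
Contact-partner-unique w f kx ky =
  let zk , far-x , adj-x      = Contact⇒far-neighbour f kx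
      _  , far-y , adj-y      = Contact⇒far-neighbour f ky
      (_ , k⁻→k) , (_ , k→k⁺) = pad-zero-interior w zk
  in far-neighbour-unique f k⁻→k k→k⁺ far-x far-y adj-x adj-y

theorem2p7 : (w : Word) → (f : Fold (pad w)) → 2 * score (pad w) f ≤ Z w
theorem2p7 w f = begin
  2 * score (pad w) f              ≡⟨ cong (2 *_) (score≡length-contacts f) ⟩
  2 * length (contacts f)          ≡⟨ sym (length-endpoints (contacts f)) ⟩
  length (endpoints (contacts f))  ≤⟨ Unique∧⊆⇒length≤ unique-endpoints endpoints-zero ⟩
  length (zeroPositions (pad w))   ≡⟨ length-zeroPositions (pad w) ⟩
  Z (pad w)                        ≡⟨ Z-pad w ⟩
  Z w                              ∎
  where
  open ℕP.≤-Reasoning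
  unique-endpoints : Unique (endpoints (contacts f))
  unique-endpoints = Unique-endpoints (Contact f) (Contact-asym f) (Contact-partner-unique w f)
                                      (All-Contact-contacts f) (Unique-contacts f)
  endpoints-zero : All (_∈ zeroPositions (pad w)) (endpoints (contacts f))
  endpoints-zero = All-endpoints (All.map zeros (All-Contact-contacts f))
    where
    zeros : ∀ {(i , j) : _ × _} → Contact f i j →
            i ∈ zeroPositions (pad w) × j ∈ zeroPositions (pad w)
    zeros (_ , zi , zj , _) = ∈-zeroPositions (pad w) zi , ∈-zeroPositions (pad w) zj
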